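{- Suppose $m$ items arrive independently, each being item $j$ with probability $p_j$ (where $\sum_j p_j=1$ over a fixed finite set of item types), and let $M$ be the resulting random multiset. Let $w_1,\dots,w_n$ be valuations of the agents on multisets. Then $\mathbf{E}[OPT(M)]\le LP$, where $$LP=\max\sum_{i,S}x_{i,S}\,w_i(S)\quad\text{s.t.}\quad \sum_{i,S}x_{i,S}\,c_j(S)\le p_j m\ \ \forall j;\qquad \sum_S x_{i,S}=1\ \ \forall i;\qquad x_{i,S}\ge 0\ \ \forall i,S,$$ $S$ ranges over all multisets of at most $m$ items, and $c_j(S)\ge 0$ denotes the number of copies of $j$ in $S$.
   Context: $OPT(M)$ denotes the maximum of $\sum_{i=1}^n w_i(S_i)$ over all ways of partitioning the multiset $M$ into multisets $S_1,\dots,S_n$ (agent $i$ receiving $S_i$), where each $w_i$ is a real-valued function on multisets of items. -}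

module Defs where

open import Level using (Level; _⊔_) renaming (suc to lsuc)
open import Algebra.Bundles using (CommutativeRing)
open import Relation.Binary.Structures using (IsTotalOrder)
open import Data.Nat as ℕ using (ℕ; zero; suc; _∸_)
open import Data.Fin using (Fin; _≟_)
open import Data.Vec using (Vec; []; _∷_; lookup; tabulate)
open import Data.List using (List; []; _∷_; map; concatMap; upTo; allFin; foldr)
open import Relation.Nullary.Decidable using (does)
open import Data.Bool using (if_then_else_)

-- A (totally) ordered commutative ring.  The real numbers are an
-- instance; the theorem is stated for every such ring, so in particular
-- for ℝ.

record OrderedCommRing (c ℓ₁ ℓ₂ : Level) : Set (lsuc (c ⊔ ℓ₁ ⊔ ℓ₂)) where
  field
    commutativeRing : CommutativeRing c ℓ₁
  open CommutativeRing commutativeRing public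
  infix 4 _≤_
  field
    _≤_          : Carrier → Carrier → Set ℓ₂
    isTotalOrder : IsTotalOrder _≈_ _≤_
    +-monoˡ-≤    : ∀ {x y} z → x ≤ y → x + z ≤ y + z
    *-nonneg     : ∀ {x y} → 0# ≤ x → 0# ≤ y → 0# ≤ x * y

-- Combinatorial (ring-independent) notions.
-- Item types are Fin k.  A multiset of items is its count vector
-- Vec ℕ k  (entry j = c_j(S), the number of copies of item j).

count : ∀ {k m} → Fin k → Vec (Fin k) m → ℕ
count j []      = zero
count j (a ∷ s) = if does (j ≟ a) then suc (count j s) else count j s

multisetOf : ∀ {k m} → Vec (Fin k) m → Vec ℕ k
multisetOf s = tabulate (λ j → count j s)

-- all sequences of m items (the sample space of the arrival process)
allSeqs : ∀ k m → List (Vec (Fin k) m)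
allSeqs k zero    = [] ∷ []
allSeqs k (suc m) = concatMap (λ a → map (a ∷_) (allSeqs k m)) (allFin k)

-- all multisets over Fin k with at most m items, each listed once
multisetsUpTo : ∀ k → ℕ → List (Vec ℕ k)
multisetsUpTo zero    m = [] ∷ []
multisetsUpTo (suc k) m =
  concatMap (λ c → map (c ∷_) (multisetsUpTo k (m ∸ c))) (upTo (suc m))

sumℕ : ∀ {n} → (Fin n → ℕ) → ℕ
sumℕ {zero}  f = zero
sumℕ {suc n} f = f Fin.zero ℕ.+ sumℕ (λ i → f (Fin.suc i))
  where import Data.Fin as Fin

IsPartition : ∀ {n k} → Vec ℕ k → (Fin n → Vec ℕ k) → Set
IsPartition {n} M S = ∀ j → sumℕ (λ i → lookup (S i) j) ≡ lookup M j
  where open import Relation.Binary.PropositionalEquality using (_≡_)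

module WithRing {c ℓ₁ ℓ₂} (R : OrderedCommRing c ℓ₁ ℓ₂) where
  open OrderedCommRing R

  fromℕ : ℕ → Carrier
  fromℕ zero    = 0#
  fromℕ (suc n) = 1# + fromℕ n

  sumL : ∀ {a} {A : Set a} → List A → (A → Carrier) → Carrier
  sumL xs f = foldr (λ x acc → f x + acc) 0# xs

  sumF : ∀ {n} → (Fin n → Carrier) → Carrier
  sumF {n} f = sumL (allFin n) f

  prodV : ∀ {k m} → (Fin k → Carrier) → Vec (Fin k) m → Carrier
  prodV p []      = 1#
  prodV p (a ∷ s) = p a * prodV p s

  IsDistribution : ∀ {k} → (Fin k → Carrier) → Set (ℓ₁ ⊔ ℓ₂)
  IsDistribution {k} p = (∀ j → 0# ≤ p j) × (sumF p ≈ 1#)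
    where open import Data.Product using (_×_)

  -- E[ f(M) ] for M the multiset of m i.i.d. arrivals with law p
  expect : ∀ {k} (m : ℕ) → (Fin k → Carrier) → (Vec ℕ k → Carrier) → Carrier
  expect {k} m p f = sumL (allSeqs k m) (λ s → prodV p s * f (multisetOf s))

  welfare : ∀ {n k} → (Fin n → Vec ℕ k → Carrier) → (Fin n → Vec ℕ k) → Carrier
  welfare w S = sumF (λ i → w i (S i))

  IsOPT : ∀ {n k} → (Fin n → Vec ℕ k → Carrier) → Vec ℕ k → Carrier → Set (ℓ₁ ⊔ ℓ₂)
  IsOPT {n} {k} w M v =
      (Σ[ S ∈ (Fin n → Vec ℕ k) ] IsPartition M S × (welfare w S ≈ v))
    × (∀ (S : Fin n → Vec ℕ k) → IsPartition M S → welfare w S ≤ v)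
    where open import Data.Product using (_×_; Σ-syntax)

  LPFeasible : ∀ {n k} (m : ℕ) → (Fin k → Carrier) → (Fin n → Vec ℕ k → Carrier) → Set (ℓ₁ ⊔ ℓ₂)
  LPFeasible {n} {k} m p x =
      (∀ j → sumF (λ i → sumL (multisetsUpTo k m) (λ S → x i S * fromℕ (lookup S j)))
               ≤ p j * fromℕ m)
    × (∀ i → sumL (multisetsUpTo k m) (λ S → x i S) ≈ 1#)
    × (∀ i S → 0# ≤ x i S)
    where open import Data.Product using (_×_)

  LPObjective : ∀ {n k} (m : ℕ) → (Fin n → Vec ℕ k → Carrier) → (Fin n → Vec ℕ k → Carrier) → Carrier
  LPObjective {n} {k} m w x = sumF (λ i → sumL (multisetsUpTo k m) (λ S → x i S * w i S))

module Submission where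

-- For every arrival sequence s fix an optimal partition S(s) of
-- M(s) = multisetOf s, and let x i S be the probability that agent i
-- receives exactly the bundle S, i.e. the law of the random bundle S(s) i.
-- Since every bundle has at most m items, it is listed exactly once among
-- the LP variables, so summing x i S * g S over the LP variables computes
-- E[g(S(s) i)] for every g (the pushforward identity).  With g = c_j this
-- turns the packing constraint into E[count_j] = p_j m, with g = 1 the
-- normalisation into total probability 1, and with g = w i the objective
-- into E[welfare of S(s)] = E[OPT(M)].  So the constraints hold with
-- equality and the LP value of x is exactly E[OPT(M)].

open import Defs
open import Data.Nat using (ℕ)
open import Data.Fin using (Fin)
open import Data.Vec using (Vec)
open import Data.Product using (Σ-syntax; _×_)

open import Level using (Level)
open import Function using (_∘_)
open import Data.Bool using (true; false; if_then_else_)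
open import Data.Nat as ℕ using (zero; suc; _∸_; s≤s; z≤n)
  renaming (_+_ to _+ℕ_; _≤_ to _≤ℕ_; _<_ to _<ℕ_)
import Data.Nat.Properties as ℕP
import Data.Fin as Fin
open import Data.Fin.Properties using () renaming (suc-injective to Fin-suc-injective)
open import Data.Vec using ([]; _∷_; head; lookup; tabulate) renaming (sum to size)
open import Data.Vec.Properties using (≡-dec; lookup∘tabulate; ∷-injectiveʳ)
open import Data.List as List using (List; map; concatMap; allFin; applyUpTo; upTo; _++_)
open import Data.List.Properties using (map-tabulate)
open import Data.Product using (_,_; proj₁; proj₂)
open import Data.Sum using (inj₁; inj₂)
open import Relation.Nullary using (does; yes; no)
open import Relation.Nullary.Negation using (contradiction)
open import Relation.Binary.Definitions using (DecidableEquality)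
open import Relation.Binary.Structures using (IsTotalOrder)
open import Relation.Binary.PropositionalEquality as P using (_≡_; _≢_)
import Algebra.Properties.Ring as RingProperties
import Algebra.Properties.CommutativeSemigroup as CommSemigroupProperties

module CountVectors where

  summand≤sumℕ : ∀ {n} (f : Fin n → ℕ) i → f i ≤ℕ sumℕ f
  summand≤sumℕ f Fin.zero    = ℕP.m≤m+n _ _
  summand≤sumℕ f (Fin.suc i) =
    ℕP.≤-trans (summand≤sumℕ (f ∘ Fin.suc) i) (ℕP.m≤n+m _ _)

  size-mono : ∀ {k} (u v : Vec ℕ k) → (∀ j → lookup u j ≤ℕ lookup v j) → size u ≤ℕ size v
  size-mono []      []      _ = z≤n
  size-mono (a ∷ u) (b ∷ v) h = ℕP.+-mono-≤ (h Fin.zero) (size-mono u v (h ∘ Fin.suc))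

  part-size≤ : ∀ {n k} (M : Vec ℕ k) (S : Fin n → Vec ℕ k) →
               IsPartition M S → ∀ i → size (S i) ≤ℕ size M
  part-size≤ M S partition i = size-mono (S i) M λ j →
    P.subst (lookup (S i) j ≤ℕ_) (partition j) (summand≤sumℕ (λ i → lookup (S i) j) i)

  size-zeros : ∀ k → size (tabulate {n = k} (λ _ → 0)) ≡ 0
  size-zeros zero    = P.refl
  size-zeros (suc k) = size-zeros k

  size-insert : ∀ {k} (a : Fin k) (c : Fin k → ℕ) →
    size (tabulate (λ j → if does (j Fin.≟ a) then suc (c j) else c j))
      ≡ suc (size (tabulate c))
  size-insert Fin.zero    c = P.refl
  size-insert (Fin.suc a) c =
    P.trans (P.cong (c Fin.zero +ℕ_) (size-insert a (c ∘ Fin.suc))) (ℕP.+-suc _ _)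

  size-multisetOf : ∀ {k m} (s : Vec (Fin k) m) → size (multisetOf s) ≡ m
  size-multisetOf {k} []      = size-zeros k
  size-multisetOf     (a ∷ s) =
    P.trans (size-insert a (λ j → count j s)) (P.cong suc (size-multisetOf s))

open CountVectors

module Proof {c ℓ₁ ℓ₂} (R : OrderedCommRing c ℓ₁ ℓ₂) where
  open OrderedCommRing R
  open WithRing R
  open IsTotalOrder isTotalOrder using (total)
    renaming (reflexive to ≤-reflexive; trans to ≤-trans; ≤-respˡ-≈ to ≤-respˡ; ≤-respʳ-≈ to ≤-respʳ)
  open RingProperties ring using (-1*x≈-x; -‿involutive)
  open CommSemigroupProperties +-commutativeSemigroup using (interchange)
  open import Relation.Binary.Reasoning.Setoid setoid

  private
    variable
      a b : Level
      A : Set a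
      B : Set b

  -- In a totally ordered ring 1 is nonnegative: otherwise -1 ≥ 0 and
  -- 1 = (-1)(-1) ≥ 0.
  0≤1 : 0# ≤ 1#
  0≤1 with total 0# 1#
  ... | inj₁ 0≤1# = 0≤1#
  ... | inj₂ 1≤0# = ≤-respʳ (trans (-1*x≈-x (- 1#)) (-‿involutive 1#)) (*-nonneg 0≤-1 0≤-1)
    where
    0≤-1 : 0# ≤ - 1#
    0≤-1 = ≤-respʳ (+-identityˡ _) (≤-respˡ (-‿inverseʳ 1#) (+-monoˡ-≤ (- 1#) 1≤0#))

  sumL-cong : (xs : List A) {f g : A → Carrier} → (∀ x → f x ≈ g x) → sumL xs f ≈ sumL xs g
  sumL-cong List.[]       h = refl
  sumL-cong (x List.∷ xs) h = +-cong (h x) (sumL-cong xs h)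

  sumL-zero : (xs : List A) (f : A → Carrier) → (∀ x → f x ≈ 0#) → sumL xs f ≈ 0#
  sumL-zero List.[]       f h = refl
  sumL-zero (x List.∷ xs) f h = trans (+-cong (h x) (sumL-zero xs f h)) (+-identityˡ 0#)

  sumL-+ : (xs : List A) (f g : A → Carrier) →
           sumL xs (λ x → f x + g x) ≈ sumL xs f + sumL xs g
  sumL-+ List.[]       f g = sym (+-identityˡ 0#)
  sumL-+ (x List.∷ xs) f g = trans (+-cong refl (sumL-+ xs f g)) (interchange _ _ _ _)

  sumL-*ˡ : (xs : List A) (r : Carrier) (f : A → Carrier) →
            sumL xs (λ x → r * f x) ≈ r * sumL xs f
  sumL-*ˡ List.[]       r f = sym (zeroʳ r)
  sumL-*ˡ (x List.∷ xs) r f = trans (+-cong refl (sumL-*ˡ xs r f)) (sym (distribˡ r _ _))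

  sumL-*ʳ : (xs : List A) (r : Carrier) (f : A → Carrier) →
            sumL xs (λ x → f x * r) ≈ sumL xs f * r
  sumL-*ʳ xs r f = begin
    sumL xs (λ x → f x * r) ≈⟨ sumL-cong xs (λ x → *-comm (f x) r) ⟩
    sumL xs (λ x → r * f x) ≈⟨ sumL-*ˡ xs r f ⟩
    r * sumL xs f           ≈⟨ *-comm r _ ⟩
    sumL xs f * r           ∎

  sumL-nonneg : (xs : List A) (f : A → Carrier) → (∀ x → 0# ≤ f x) → 0# ≤ sumL xs f
  sumL-nonneg List.[]       f h = ≤-reflexive refl
  sumL-nonneg (x List.∷ xs) f h =
    ≤-trans (≤-respʳ (sym (+-identityˡ _)) (sumL-nonneg xs f h)) (+-monoˡ-≤ _ (h x))

  sumL-++ : (xs ys : List A) (f : A → Carrier) → sumL (xs ++ ys) f ≈ sumL xs f + sumL ys f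
  sumL-++ List.[]       ys f = sym (+-identityˡ _)
  sumL-++ (x List.∷ xs) ys f = trans (+-cong refl (sumL-++ xs ys f)) (sym (+-assoc _ _ _))

  sumL-map : (xs : List B) (g : B → A) (f : A → Carrier) → sumL (map g xs) f ≡ sumL xs (f ∘ g)
  sumL-map List.[]       g f = P.refl
  sumL-map (x List.∷ xs) g f = P.cong (f (g x) +_) (sumL-map xs g f)

  sumL-concatMap : (xs : List B) (g : B → List A) (f : A → Carrier) →
                   sumL (concatMap g xs) f ≈ sumL xs (λ y → sumL (g y) f)
  sumL-concatMap List.[]       g f = refl
  sumL-concatMap (x List.∷ xs) g f =
    trans (sumL-++ (g x) (concatMap g xs) f) (+-cong refl (sumL-concatMap xs g f))

  sumL-swap : (xs : List A) (ys : List B) (f : A → B → Carrier) →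
              sumL xs (λ x → sumL ys (f x)) ≈ sumL ys (λ y → sumL xs (λ x → f x y))
  sumL-swap List.[]       ys f = sym (sumL-zero ys _ (λ _ → refl))
  sumL-swap (x List.∷ xs) ys f =
    trans (+-cong refl (sumL-swap xs ys f)) (sym (sumL-+ ys (f x) _))

  sumL-applyUpTo-zero : ∀ n (g : ℕ → A) (f : A → Carrier) →
    (∀ i → f (g i) ≈ 0#) → sumL (applyUpTo g n) f ≈ 0#
  sumL-applyUpTo-zero zero    g f h = refl
  sumL-applyUpTo-zero (suc n) g f h =
    trans (+-cong (h 0) (sumL-applyUpTo-zero n (g ∘ suc) f (h ∘ suc))) (+-identityˡ 0#)

  sumL-applyUpTo-point : ∀ n (g : ℕ → A) (f : A → Carrier) t → t <ℕ n →
    (∀ i → i ≢ t → f (g i) ≈ 0#) → sumL (applyUpTo g n) f ≈ f (g t)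
  sumL-applyUpTo-point (suc n) g f zero _ vanish =
    trans (+-cong refl (sumL-applyUpTo-zero n (g ∘ suc) f (λ i → vanish (suc i) (λ ()))))
          (+-identityʳ _)
  sumL-applyUpTo-point (suc n) g f (suc t) (s≤s t<n) vanish =
    trans (+-cong (vanish 0 (λ ())) (sumL-applyUpTo-point n (g ∘ suc) f t t<n
                                       (λ i i≢t → vanish (suc i) (i≢t ∘ ℕP.suc-injective))))
          (+-identityˡ _)

  sumF-suc : ∀ {n} (f : Fin (suc n) → Carrier) → sumF f ≡ f Fin.zero + sumF (f ∘ Fin.suc)
  sumF-suc {n} f = P.cong (f Fin.zero +_) (P.trans
    (P.cong (λ xs → sumL xs f) (P.sym (map-tabulate (λ i → i) Fin.suc)))
    (sumL-map (allFin n) Fin.suc f))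

  sumF-point : ∀ {n} (f : Fin n → Carrier) j → (∀ i → i ≢ j → f i ≈ 0#) → sumF f ≈ f j
  sumF-point f Fin.zero vanish = begin
    sumF f                             ≡⟨ sumF-suc f ⟩
    f Fin.zero + sumF (f ∘ Fin.suc)    ≈⟨ +-cong refl (sumL-zero (allFin _) _ (λ i → vanish (Fin.suc i) (λ ()))) ⟩
    f Fin.zero + 0#                    ≈⟨ +-identityʳ _ ⟩
    f Fin.zero                         ∎
  sumF-point f (Fin.suc j) vanish = begin
    sumF f                             ≡⟨ sumF-suc f ⟩
    f Fin.zero + sumF (f ∘ Fin.suc)    ≈⟨ +-cong (vanish Fin.zero (λ ())) (sumF-point (f ∘ Fin.suc) j
                                            (λ i i≢j → vanish (Fin.suc i) (i≢j ∘ Fin-suc-injective))) ⟩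
    0# + f (Fin.suc j)                 ≈⟨ +-identityˡ _ ⟩
    f (Fin.suc j)                      ∎

  fromℕ-+ : ∀ m n → fromℕ (m +ℕ n) ≈ fromℕ m + fromℕ n
  fromℕ-+ zero    n = sym (+-identityˡ _)
  fromℕ-+ (suc m) n = trans (+-cong refl (fromℕ-+ m n)) (sym (+-assoc _ _ _))

  fromℕ-sumℕ : ∀ {n} (f : Fin n → ℕ) → fromℕ (sumℕ f) ≈ sumF (fromℕ ∘ f)
  fromℕ-sumℕ {zero}  f = refl
  fromℕ-sumℕ {suc n} f = begin
    fromℕ (f Fin.zero +ℕ sumℕ (f ∘ Fin.suc))          ≈⟨ fromℕ-+ (f Fin.zero) (sumℕ (f ∘ Fin.suc)) ⟩
    fromℕ (f Fin.zero) + fromℕ (sumℕ (f ∘ Fin.suc))   ≈⟨ +-cong refl (fromℕ-sumℕ (f ∘ Fin.suc)) ⟩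
    fromℕ (f Fin.zero) + sumF (fromℕ ∘ f ∘ Fin.suc)   ≡⟨ P.sym (sumF-suc (fromℕ ∘ f)) ⟩
    sumF (fromℕ ∘ f)                                   ∎

  δ : DecidableEquality A → A → A → Carrier
  δ _≟_ a b = if does (a ≟ b) then 1# else 0#

  δ-self : (_≟_ : DecidableEquality A) (a : A) → δ _≟_ a a ≈ 1#
  δ-self _≟_ a with a ≟ a
  ... | yes _  = refl
  ... | no a≢a = contradiction P.refl a≢a

  δ-off : (_≟_ : DecidableEquality A) {a b : A} → a ≢ b → δ _≟_ a b ≈ 0#
  δ-off _≟_ {a} {b} a≢b with a ≟ b
  ... | yes a≡b = contradiction a≡b a≢b
  ... | no _    = refl

  δ-nonneg : (_≟_ : DecidableEquality A) (a b : A) → 0# ≤ δ _≟_ a b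
  δ-nonneg _≟_ a b with does (a ≟ b)
  ... | true  = 0≤1
  ... | false = ≤-reflexive refl

  multisetsUpTo-point : ∀ k m (T : Vec ℕ k) (f : Vec ℕ k → Carrier) → size T ≤ℕ m →
    (∀ S → S ≢ T → f S ≈ 0#) → sumL (multisetsUpTo k m) f ≈ f T
  multisetsUpTo-point zero    m []      f _ _ = +-identityʳ _
  multisetsUpTo-point (suc k) m (t ∷ T) f size≤m vanish = begin
    sumL (concatMap (λ a → map (a ∷_) (rows a)) (upTo (suc m))) f
      ≈⟨ sumL-concatMap (upTo (suc m)) (λ a → map (a ∷_) (rows a)) f ⟩
    sumL (upTo (suc m)) (λ a → sumL (map (a ∷_) (rows a)) f)
      ≈⟨ sumL-cong (upTo (suc m)) (λ a → reflexive (sumL-map (rows a) (a ∷_) f)) ⟩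
    sumL (upTo (suc m)) row
      ≈⟨ sumL-applyUpTo-point (suc m) (λ i → i) row t (s≤s t≤m) other-rows-vanish ⟩
    row t
      ≈⟨ multisetsUpTo-point k (m ∸ t) T (λ S → f (t ∷ S)) size-T≤m∸t
           (λ S S≢T → vanish (t ∷ S) (S≢T ∘ ∷-injectiveʳ)) ⟩
    f (t ∷ T) ∎
    where
    rows : ℕ → List (Vec ℕ k)
    rows a = multisetsUpTo k (m ∸ a)
    row : ℕ → Carrier
    row a = sumL (rows a) (λ S → f (a ∷ S))
    other-rows-vanish : ∀ a → a ≢ t → row a ≈ 0#
    other-rows-vanish a a≢t = sumL-zero (rows a) _ (λ S → vanish (a ∷ S) (a≢t ∘ P.cong head))
    t≤m : t ≤ℕ m
    t≤m = ℕP.≤-trans (ℕP.m≤m+n t (size T)) size≤m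
    size-T≤m∸t : size T ≤ℕ m ∸ t
    size-T≤m∸t = P.subst (_≤ℕ m ∸ t) (ℕP.m+n∸m≡n t (size T)) (ℕP.∸-monoˡ-≤ t size≤m)

  lawOf : ∀ {k} {Ω : Set a} → List Ω → (Ω → Carrier) → (Ω → Vec ℕ k) → Vec ℕ k → Carrier
  lawOf xs pr T S = sumL xs (λ ω → pr ω * δ (≡-dec ℕ._≟_) (T ω) S)

  lawOf-nonneg : ∀ {k} {Ω : Set a} (xs : List Ω) (pr : Ω → Carrier) (T : Ω → Vec ℕ k) →
                 (∀ ω → 0# ≤ pr ω) → ∀ S → 0# ≤ lawOf xs pr T S
  lawOf-nonneg xs pr T pr≥0 S =
    sumL-nonneg xs _ (λ ω → *-nonneg (pr≥0 ω) (δ-nonneg (≡-dec ℕ._≟_) (T ω) S))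

  lawOf-integral : ∀ {k} m {Ω : Set a} (xs : List Ω) (pr : Ω → Carrier) (T : Ω → Vec ℕ k) →
    (∀ ω → size (T ω) ≤ℕ m) → (g : Vec ℕ k → Carrier) →
    sumL (multisetsUpTo k m) (λ S → lawOf xs pr T S * g S) ≈ sumL xs (λ ω → pr ω * g (T ω))
  lawOf-integral {k = k} m {Ω} xs pr T small g = begin
    sumL U (λ S → lawOf xs pr T S * g S)
      ≈⟨ sumL-cong U (λ S → sym (sumL-*ʳ xs (g S) _)) ⟩
    sumL U (λ S → sumL xs (λ ω → term ω S))
      ≈⟨ sumL-swap U xs _ ⟩
    sumL xs (λ ω → sumL U (term ω))
      ≈⟨ sumL-cong xs (λ ω → multisetsUpTo-point k m (T ω) (term ω) (small ω) (off ω)) ⟩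
    sumL xs (λ ω → term ω (T ω))
      ≈⟨ sumL-cong xs (λ ω → *-cong (trans (*-cong refl (δ-self _≟_ (T ω))) (*-identityʳ _)) refl) ⟩
    sumL xs (λ ω → pr ω * g (T ω)) ∎
    where
    U : List (Vec ℕ k)
    U = multisetsUpTo k m
    _≟_ : DecidableEquality (Vec ℕ k)
    _≟_ = ≡-dec ℕ._≟_
    term : Ω → Vec ℕ k → Carrier
    term ω S = (pr ω * δ _≟_ (T ω) S) * g S
    off : ∀ ω S → S ≢ T ω → term ω S ≈ 0#
    off ω S S≢T = trans (*-cong (trans (*-cong refl (δ-off _≟_ (S≢T ∘ P.sym))) (zeroʳ _)) refl) (zeroˡ _)

  module Arrivals {k : ℕ} (p : Fin k → Carrier) (dist : IsDistribution p) where

    𝔼 : ∀ m → (Vec (Fin k) m → Carrier) → Carrier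
    𝔼 m g = sumL (allSeqs k m) (λ s → prodV p s * g s)

    prodV-nonneg : ∀ {m} (s : Vec (Fin k) m) → 0# ≤ prodV p s
    prodV-nonneg []      = 0≤1
    prodV-nonneg (a ∷ s) = *-nonneg (proj₁ dist a) (prodV-nonneg s)

    𝔼-cong : ∀ m {f g : Vec (Fin k) m → Carrier} → (∀ s → f s ≈ g s) → 𝔼 m f ≈ 𝔼 m g
    𝔼-cong m h = sumL-cong (allSeqs k m) (λ s → *-cong refl (h s))

    𝔼-+ : ∀ m (f g : Vec (Fin k) m → Carrier) → 𝔼 m (λ s → f s + g s) ≈ 𝔼 m f + 𝔼 m g
    𝔼-+ m f g = trans (sumL-cong (allSeqs k m) (λ s → distribˡ (prodV p s) _ _))
                      (sumL-+ (allSeqs k m) _ _)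

    𝔼-sumF : ∀ m {n} (f : Fin n → Vec (Fin k) m → Carrier) →
             sumF (λ i → 𝔼 m (f i)) ≈ 𝔼 m (λ s → sumF (λ i → f i s))
    𝔼-sumF m {n} f =
      trans (sumL-swap (allFin n) (allSeqs k m) _)
            (sumL-cong (allSeqs k m) (λ s → sumL-*ˡ (allFin n) (prodV p s) (λ i → f i s)))

    𝔼-step : ∀ m (g : Vec (Fin k) (suc m) → Carrier) →
             𝔼 (suc m) g ≈ sumF (λ a → p a * 𝔼 m (λ s → g (a ∷ s)))
    𝔼-step m g = begin
      sumL (concatMap (λ a → map (a ∷_) (allSeqs k m)) (allFin k)) term
        ≈⟨ sumL-concatMap (allFin k) _ term ⟩
      sumF (λ a → sumL (map (a ∷_) (allSeqs k m)) term)
        ≈⟨ sumL-cong (allFin k) (λ a → reflexive (sumL-map (allSeqs k m) (a ∷_) term)) ⟩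
      sumF (λ a → sumL (allSeqs k m) (λ s → (p a * prodV p s) * g (a ∷ s)))
        ≈⟨ sumL-cong (allFin k) (λ a → trans (sumL-cong (allSeqs k m) (λ s → *-assoc _ _ _))
                                             (sumL-*ˡ (allSeqs k m) (p a) _)) ⟩
      sumF (λ a → p a * 𝔼 m (λ s → g (a ∷ s))) ∎
      where
      term : Vec (Fin k) (suc m) → Carrier
      term s = prodV p s * g s

    𝔼-const : ∀ m r → 𝔼 m (λ _ → r) ≈ r
    𝔼-const zero    r = trans (+-identityʳ _) (*-identityˡ r)
    𝔼-const (suc m) r = begin
      𝔼 (suc m) (λ _ → r)            ≈⟨ 𝔼-step m (λ _ → r) ⟩
      sumF (λ a → p a * 𝔼 m (λ _ → r)) ≈⟨ sumL-cong (allFin k) (λ a → *-cong refl (𝔼-const m r)) ⟩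
      sumF (λ a → p a * r)           ≈⟨ sumL-*ʳ (allFin k) r p ⟩
      sumF p * r                     ≈⟨ *-cong (proj₂ dist) refl ⟩
      1# * r                         ≈⟨ *-identityˡ r ⟩
      r                              ∎

    count-step : ∀ {m} j a (s : Vec (Fin k) m) →
                 fromℕ (count j (a ∷ s)) ≈ δ Fin._≟_ j a + fromℕ (count j s)
    count-step j a s with does (j Fin.≟ a)
    ... | true  = refl
    ... | false = sym (+-identityˡ _)

    p-point : ∀ j → sumF (λ a → p a * δ Fin._≟_ j a) ≈ p j
    p-point j = trans (sumF-point _ j off) (trans (*-cong refl (δ-self Fin._≟_ j)) (*-identityʳ _))
      where
      off : ∀ a → a ≢ j → p a * δ Fin._≟_ j a ≈ 0#
      off a a≢j = trans (*-cong refl (δ-off Fin._≟_ (a≢j ∘ P.sym))) (zeroʳ _)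

    expected-count : ∀ j m → 𝔼 m (λ s → fromℕ (count j s)) ≈ p j * fromℕ m
    expected-count j zero    = trans (+-identityʳ _) (trans (zeroʳ 1#) (sym (zeroʳ (p j))))
    expected-count j (suc m) = begin
      𝔼 (suc m) (λ s → fromℕ (count j s))
        ≈⟨ 𝔼-step m _ ⟩
      sumF (λ a → p a * 𝔼 m (λ s → fromℕ (count j (a ∷ s))))
        ≈⟨ sumL-cong (allFin k) (λ a → trans (*-cong refl (first-arrival a)) (distribˡ (p a) _ _)) ⟩
      sumF (λ a → p a * δ Fin._≟_ j a + p a * (p j * fromℕ m))
        ≈⟨ sumL-+ (allFin k) _ _ ⟩
      sumF (λ a → p a * δ Fin._≟_ j a) + sumF (λ a → p a * (p j * fromℕ m))
        ≈⟨ +-cong (p-point j) (trans (sumL-*ʳ (allFin k) _ p) (*-cong (proj₂ dist) refl)) ⟩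
      p j + 1# * (p j * fromℕ m)
        ≈⟨ +-cong (sym (*-identityʳ (p j))) (*-identityˡ _) ⟩
      p j * 1# + p j * fromℕ m
        ≈⟨ sym (distribˡ (p j) 1# (fromℕ m)) ⟩
      p j * fromℕ (suc m) ∎
      where
      first-arrival : ∀ a → 𝔼 m (λ s → fromℕ (count j (a ∷ s))) ≈ δ Fin._≟_ j a + p j * fromℕ m
      first-arrival a = trans (𝔼-cong m (count-step j a))
                              (trans (𝔼-+ m _ _) (+-cong (𝔼-const m _) (expected-count j m)))

  module Allocation {n k : ℕ} (m : ℕ) (p : Fin k → Carrier) (dist : IsDistribution p)
                    (alloc : Vec (Fin k) m → Fin n → Vec ℕ k)
                    (partition : ∀ s → IsPartition (multisetOf s) (alloc s)) where
    open Arrivals p dist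

    -- x i S = Pr[agent i receives the bundle S]; this is the LP solution.
    x : Fin n → Vec ℕ k → Carrier
    x i = lawOf (allSeqs k m) (prodV p) (λ s → alloc s i)

    bundle-small : ∀ i s → size (alloc s i) ≤ℕ m
    bundle-small i s = P.subst (size (alloc s i) ≤ℕ_) (size-multisetOf s)
                               (part-size≤ (multisetOf s) (alloc s) (partition s) i)

    integral : ∀ i (g : Vec ℕ k → Carrier) →
               sumL (multisetsUpTo k m) (λ S → x i S * g S) ≈ 𝔼 m (λ s → g (alloc s i))
    integral i = lawOf-integral m (allSeqs k m) (prodV p) (λ s → alloc s i) (bundle-small i)

    total-integral : (g : Fin n → Vec ℕ k → Carrier) →
      sumF (λ i → sumL (multisetsUpTo k m) (λ S → x i S * g i S))
        ≈ 𝔼 m (λ s → sumF (λ i → g i (alloc s i)))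
    total-integral g = trans (sumL-cong (allFin n) (λ i → integral i (g i)))
                             (𝔼-sumF m (λ i s → g i (alloc s i)))

    packing : ∀ j → sumF (λ i → sumL (multisetsUpTo k m) (λ S → x i S * fromℕ (lookup S j)))
                    ≈ p j * fromℕ m
    packing j = begin
      sumF (λ i → sumL (multisetsUpTo k m) (λ S → x i S * fromℕ (lookup S j)))
        ≈⟨ total-integral (λ _ S → fromℕ (lookup S j)) ⟩
      𝔼 m (λ s → sumF (λ i → fromℕ (lookup (alloc s i) j)))
        ≈⟨ 𝔼-cong m (λ s → sym (fromℕ-sumℕ (λ i → lookup (alloc s i) j))) ⟩
      𝔼 m (λ s → fromℕ (sumℕ (λ i → lookup (alloc s i) j)))
        ≈⟨ 𝔼-cong m (λ s → reflexive (P.cong fromℕ (parts-count s))) ⟩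
      𝔼 m (λ s → fromℕ (count j s))
        ≈⟨ expected-count j m ⟩
      p j * fromℕ m ∎
      where
      parts-count : ∀ s → sumℕ (λ i → lookup (alloc s i) j) ≡ count j s
      parts-count s = P.trans (partition s j) (lookup∘tabulate (λ j → count j s) j)

    normalised : ∀ i → sumL (multisetsUpTo k m) (x i) ≈ 1#
    normalised i = trans (sumL-cong (multisetsUpTo k m) (λ S → sym (*-identityʳ (x i S))))
                         (trans (integral i (λ _ → 1#)) (𝔼-const m 1#))

    feasible : LPFeasible m p x
    feasible = (λ j → ≤-reflexive (packing j))
             , normalised
             , (λ i → lawOf-nonneg (allSeqs k m) (prodV p) (λ s → alloc s i) prodV-nonneg)

  theorem : (n k m : ℕ) (p : Fin k → Carrier) → IsDistribution p →
       (w : Fin n → Vec ℕ k → Carrier) →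
       (opt : Vec ℕ k → Carrier) →
       (∀ (s : Vec (Fin k) m) → IsOPT w (multisetOf s) (opt (multisetOf s))) →
       Σ[ x ∈ (Fin n → Vec ℕ k → Carrier) ]
         (LPFeasible m p x × (expect m p opt ≤ LPObjective m w x))
  theorem n k m p dist w opt isOpt = x , feasible , ≤-reflexive (sym LP≈E[OPT])
    where
    optimal : Vec (Fin k) m → Fin n → Vec ℕ k
    optimal s = proj₁ (proj₁ (isOpt s))
    open Allocation m p dist optimal (λ s → proj₁ (proj₂ (proj₁ (isOpt s))))
    open Arrivals p dist using (𝔼-cong)
    LP≈E[OPT] : LPObjective m w x ≈ expect m p opt
    LP≈E[OPT] = trans (total-integral w) (𝔼-cong m (λ s → proj₂ (proj₂ (proj₁ (isOpt s)))))

lemma4p5 : ∀ {c ℓ₁ ℓ₂} (R : OrderedCommRing c ℓ₁ ℓ₂) →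
  let open OrderedCommRing R
      open WithRing R
  in (n k m : ℕ) (p : Fin k → Carrier) → IsDistribution p →
     (w : Fin n → Vec ℕ k → Carrier) →
     (opt : Vec ℕ k → Carrier) →
     (∀ (s : Vec (Fin k) m) → IsOPT w (multisetOf s) (opt (multisetOf s))) →
     Σ[ x ∈ (Fin n → Vec ℕ k → Carrier) ]
       (LPFeasible m p x × (expect m p opt ≤ LPObjective m w x))
lemma4p5 R = Proof.theorem R
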